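{- Let $r \geq 4$ be an integer and let $G$ be a $K_r$-saturated graph on at least $r+1$ vertices. Then $G$ is $(r-2)$-connected.
   Context: All graphs are finite and simple. For a graph $H$, a graph $G$ is $H$-saturated if $G$ contains no copy of $H$ as a subgraph and for every pair of non-adjacent vertices $u,v$ of $G$, the graph $G+uv$ contains at least one copy of $H$. A graph $G$ is $k$-connected if there is no set $S$ of $k-1$ vertices such that $G-S$ is disconnected or consists of a single vertex. -}

module Defs where

open import Data.Nat using (ℕ; suc; _∸_)
open import Data.Fin using (Fin)
open import Data.Fin.Subset using (Subset; _∈_; _∉_; ∣_∣)
open import Data.Product using (Σ; ∃; _×_; _,_)
open import Data.Sum using (_⊎_)
open import Relation.Nullary using (¬_; Dec)
open import Relation.Binary.PropositionalEquality using (_≡_; _≢_)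
open import Function.Definitions using (Injective)

record Graph (n : ℕ) : Set₁ where
  field
    Adj     : Fin n → Fin n → Set
    adj?    : ∀ u v → Dec (Adj u v)
    sym     : ∀ {u v} → Adj u v → Adj v u
    irrefl  : ∀ {u} → ¬ Adj u u
open Graph public

addEdge : ∀ {n} (G : Graph n) (u v : Fin n) → Fin n → Fin n → Set
addEdge G u v x y = Adj G x y ⊎ ((x ≡ u × y ≡ v) ⊎ (x ≡ v × y ≡ u))

HasClique : ∀ {n} (E : Fin n → Fin n → Set) (r : ℕ) → Set
HasClique {n} E r =
  Σ (Fin r → Fin n) λ f → Injective _≡_ _≡_ f × (∀ i j → i ≢ j → E (f i) (f j))

Saturated : ∀ {n} (G : Graph n) (r : ℕ) → Set
Saturated G r =
  ¬ HasClique (Adj G) r ×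
  (∀ u v → u ≢ v → ¬ Adj G u v → HasClique (addEdge G u v) r)

data Reach {n} (G : Graph n) (S : Subset n) : Fin n → Fin n → Set where
  here : ∀ {u} → u ∉ S → Reach G S u u
  step : ∀ {u v w} → u ∉ S → Adj G u v → Reach G S v w → Reach G S u w

DisconnectedAfter : ∀ {n} → Graph n → Subset n → Set
DisconnectedAfter {n} G S =
  Σ (Fin n) λ u → Σ (Fin n) λ v → u ∉ S × v ∉ S × ¬ Reach G S u v

SingleVertexAfter : ∀ {n} → Graph n → Subset n → Set
SingleVertexAfter {n} G S = Σ (Fin n) λ u → u ∉ S × (∀ v → v ∉ S → v ≡ u)

Connected : ∀ {n} → Graph n → ℕ → Set
Connected {n} G k =
  (S : Subset n) → ∣ S ∣ ≡ k ∸ 1 →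
  ¬ (DisconnectedAfter G S ⊎ SingleVertexAfter G S)

-- If S separates u from v in G, then u and v are non-adjacent, so G + uv
-- contains a K_r through the new edge. Its other r - 2 vertices are common
-- neighbours of u and v in G, and a common neighbour outside S would give a
-- path u–w–v avoiding S; hence |S| ≥ r - 2. A set S with G - S a single
-- vertex forces n ≤ |S| + 1, which is too few vertices.
module Submission where

open import Defs
open import Data.Nat using (ℕ; zero; suc; _≤_; _<_; _∸_; _+_; z≤n; s≤s)
open import Data.Nat.Properties
  using (≤-trans; ≤-reflexive; ≤-<-trans; +-comm; +-monoʳ-≤; m≤n+m; m≤n+m∸n; <⇒≱; 1+n≰n; module ≤-Reasoning)
open import Data.Fin using (Fin; punchIn; punchOut)
open import Data.Fin.Properties
  using (any?; suc-injective; 0≢1+n; punchIn-injective; punchInᵢ≢i; punchIn-punchOut)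
  renaming (_≟_ to _≟ᶠ_)
open import Data.Fin.Subset using (Subset; _∈_; _∉_; ∣_∣; _-_; ∁; ⁅_⁆; _⊆_)
open import Data.Fin.Subset.Properties
  using (_∈?_; x∈p∧x≢y⇒x∈p-y; x∈p⇒∣p-x∣<∣p∣; p⊆q⇒∣p∣≤∣q∣; ∣⁅x⁆∣≡1; ∣∁p∣≡n∸∣p∣; x∈∁p⇒x∉p; x∈⁅x⁆)
open import Data.Product using (Σ; ∃; _×_; _,_)
open import Data.Sum using (inj₁; inj₂)
open import Data.Empty using (⊥-elim)
open import Relation.Nullary using (¬_; yes; no)
open import Relation.Binary.PropositionalEquality
  using (_≡_; _≢_; trans; subst; cong)
  renaming (sym to ≡-sym)
open import Function.Definitions using (Injective)

injective⇒≤∣p∣ : ∀ {m n} {p : Subset n} (f : Fin m → Fin n) →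
                 Injective _≡_ _≡_ f → (∀ i → f i ∈ p) → m ≤ ∣ p ∣
injective⇒≤∣p∣ {zero}  _ _     _   = z≤n
injective⇒≤∣p∣ {suc m} {p = p} f f-inj f∈p =
  ≤-trans (s≤s (injective⇒≤∣p∣ {p = p - f Fin.zero} (λ i → f (Fin.suc i))
                 (λ eq → suc-injective (f-inj eq))
                 (λ i → x∈p∧x≢y⇒x∈p-y (f∈p (Fin.suc i)) (λ eq → 0≢1+n (f-inj (≡-sym eq))))))
          (x∈p⇒∣p-x∣<∣p∣ (f∈p Fin.zero))

punchIn₂ : ∀ {m} {i j : Fin (suc (suc m))} → i ≢ j → Fin m → Fin (suc (suc m))
punchIn₂ {i = i} i≢j k = punchIn i (punchIn (punchOut i≢j) k)

module _ {m} {i j : Fin (suc (suc m))} (i≢j : i ≢ j) where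

  punchIn₂-injective : Injective _≡_ _≡_ (punchIn₂ i≢j)
  punchIn₂-injective eq =
    punchIn-injective (punchOut i≢j) _ _ (punchIn-injective i _ _ eq)

  punchIn₂≢i : ∀ k → punchIn₂ i≢j k ≢ i
  punchIn₂≢i k = punchInᵢ≢i i _

  punchIn₂≢j : ∀ k → punchIn₂ i≢j k ≢ j
  punchIn₂≢j k eq = punchInᵢ≢i (punchOut i≢j) k
    (punchIn-injective i _ _ (trans eq (≡-sym (punchIn-punchOut i≢j))))

module _ {n} (G : Graph n) where

  IsClique : ∀ {r} → (Fin n → Fin n → Set) → (Fin r → Fin n) → Set
  IsClique E f = ∀ i j → i ≢ j → E (f i) (f j)

  CommonNeighbours : Fin n → Fin n → ℕ → Set
  CommonNeighbours u v m =
    Σ (Fin m → Fin n) λ g → Injective _≡_ _≡_ g × (∀ k → Adj G u (g k) × Adj G (g k) v)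

  addEdge⇒Adj : ∀ {u v x y} → addEdge G u v x y →
                ¬ (x ≡ u × y ≡ v) → ¬ (x ≡ v × y ≡ u) → Adj G x y
  addEdge⇒Adj (inj₁ xy)        _   _   = xy
  addEdge⇒Adj (inj₂ (inj₁ uv)) ¬uv _   = ⊥-elim (¬uv uv)
  addEdge⇒Adj (inj₂ (inj₂ vu)) _   ¬vu = ⊥-elim (¬vu vu)

  saturated⇒clique-through-non-edge :
    ∀ {r u v} → Saturated G r → u ≢ v → ¬ Adj G u v →
    Σ (Fin r → Fin n) λ f → Injective _≡_ _≡_ f × IsClique (addEdge G u v) f ×
      (∃ λ i → f i ≡ u) × (∃ λ j → f j ≡ v)
  saturated⇒clique-through-non-edge {u = u} {v} (noClique , saturated) u≢v ¬uv
    with saturated u v u≢v ¬uv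
  ... | f , f-inj , clique with any? (λ i → f i ≟ᶠ u) | any? (λ j → f j ≟ᶠ v)
  ... | yes ∋u | yes ∋v = f , f-inj , clique , ∋u , ∋v
  ... | no ∌u  | _      = ⊥-elim (noClique (f , f-inj , λ i j i≢j →
        addEdge⇒Adj (clique i j i≢j) (λ (eq , _) → ∌u (i , eq)) (λ (_ , eq) → ∌u (j , eq))))
  ... | yes _  | no ∌v  = ⊥-elim (noClique (f , f-inj , λ i j i≢j →
        addEdge⇒Adj (clique i j i≢j) (λ (_ , eq) → ∌v (j , eq)) (λ (eq , _) → ∌v (i , eq))))

  saturated⇒commonNeighbours : ∀ {m u v} → Saturated G (suc (suc m)) →
    u ≢ v → ¬ Adj G u v → CommonNeighbours u v m
  saturated⇒commonNeighbours {m} {u} {v} sat u≢v ¬uv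
    with saturated⇒clique-through-non-edge sat u≢v ¬uv
  ... | f , f-inj , clique , (i , fi≡u) , (j , fj≡v) =
    (λ k → f (h k)) , (λ eq → punchIn₂-injective i≢j (f-inj eq)) ,
    λ k → Graph.sym G (subst (Adj G _) fi≡u (edge k i (punchIn₂≢i i≢j k))) ,
          subst (Adj G _) fj≡v (edge k j (punchIn₂≢j i≢j k))
    where
    i≢j : i ≢ j
    i≢j eq = u≢v (trans (≡-sym fi≡u) (trans (cong f eq) fj≡v))
    h : Fin m → Fin (suc (suc m))
    h = punchIn₂ i≢j
    h≢u : ∀ k → f (h k) ≢ u
    h≢u k eq = punchIn₂≢i i≢j k (f-inj (trans eq (≡-sym fi≡u)))
    h≢v : ∀ k → f (h k) ≢ v
    h≢v k eq = punchIn₂≢j i≢j k (f-inj (trans eq (≡-sym fj≡v)))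
    edge : ∀ k l → h k ≢ l → Adj G (f (h k)) (f l)
    edge k l hk≢l = addEdge⇒Adj (clique (h k) l hk≢l)
      (λ (eq , _) → h≢u k eq) (λ (eq , _) → h≢v k eq)

  commonNeighbour∈separator : ∀ {S u v w} → u ∉ S → v ∉ S → ¬ Reach G S u v →
                              Adj G u w → Adj G w v → w ∈ S
  commonNeighbour∈separator {S} {w = w} u∉S v∉S ¬reach uw wv with w ∈? S
  ... | yes w∈S = w∈S
  ... | no  w∉S = ⊥-elim (¬reach (step u∉S uw (step w∉S wv (here v∉S))))

  saturated⇒separator-size : ∀ {m S} → Saturated G (suc (suc m)) →
                             DisconnectedAfter G S → m ≤ ∣ S ∣
  saturated⇒separator-size {S = S} sat (u , v , u∉S , v∉S , ¬reach)
    with saturated⇒commonNeighbours sat u≢v ¬uv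
    where
    u≢v : u ≢ v
    u≢v eq = ¬reach (subst (Reach G S u) eq (here u∉S))
    ¬uv : ¬ Adj G u v
    ¬uv uv = ¬reach (step u∉S uv (here v∉S))
  ... | g , g-inj , adj = injective⇒≤∣p∣ g g-inj λ k →
    let (ug , gv) = adj k in commonNeighbour∈separator u∉S v∉S ¬reach ug gv

  singleVertexAfter⇒n≤1+∣S∣ : ∀ {S} → SingleVertexAfter G S → n ≤ suc ∣ S ∣
  singleVertexAfter⇒n≤1+∣S∣ {S} (u , u∉S , unique) = begin
    n                   ≤⟨ m≤n+m∸n n ∣ S ∣ ⟩
    ∣ S ∣ + (n ∸ ∣ S ∣) ≡⟨ cong (∣ S ∣ +_) (≡-sym (∣∁p∣≡n∸∣p∣ S)) ⟩
    ∣ S ∣ + ∣ ∁ S ∣     ≤⟨ +-monoʳ-≤ ∣ S ∣ (≤-trans (p⊆q⇒∣p∣≤∣q∣ ∁S⊆⁅u⁆) (≤-reflexive (∣⁅x⁆∣≡1 u))) ⟩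
    ∣ S ∣ + 1           ≡⟨ +-comm ∣ S ∣ 1 ⟩
    suc ∣ S ∣           ∎
    where
    open ≤-Reasoning
    ∁S⊆⁅u⁆ : ∁ S ⊆ ⁅ u ⁆
    ∁S⊆⁅u⁆ {x} x∈∁S = subst (_∈ ⁅ u ⁆) (≡-sym (unique x (x∈∁p⇒x∉p x∈∁S))) (x∈⁅x⁆ u)

-- For r = 3 + m the size condition ∣ S ∣ ≡ r ∸ 2 ∸ 1 reduces to ∣ S ∣ ≡ m;
-- only r ≥ 3 is needed.
mainTheorem1 : (r n : ℕ) → 4 ≤ r → r + 1 ≤ n → (G : Graph n) →
    Saturated G r → Connected G (r ∸ 2)
mainTheorem1 (suc (suc (suc m))) n (s≤s (s≤s (s≤s _))) _ G sat S ∣S∣≡m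
  (inj₁ disconnected) =
  1+n≰n (subst (suc m ≤_) ∣S∣≡m (saturated⇒separator-size G sat disconnected))
mainTheorem1 r@(suc (suc (suc m))) n (s≤s (s≤s (s≤s _))) r+1≤n G sat S ∣S∣≡m
  (inj₂ single) =
  <⇒≱ (≤-<-trans (m≤n+m (suc m) 2) r<n)
      (subst (λ k → n ≤ suc k) ∣S∣≡m (singleVertexAfter⇒n≤1+∣S∣ G single))
  where
  r<n : r < n
  r<n = subst (_≤ n) (+-comm r 1) r+1≤n
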